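{- (Completeness of $\mathsf{TC}_{\mathsf{SCI}}$.) For every $\mathsf{SCI}$-formula $\varphi$: if $\varphi$ is $\mathsf{SCI}$-valid, then $\varphi$ has a tableau proof in $\mathsf{TC}_{\mathsf{SCI}}$, i.e., there is a closed $\mathsf{TC}_{\mathsf{SCI}}$-tableau with $w^-:\varphi$ at its root for some $w^-\in\mathsf{L}^-$.
   Context: Logic SCI. Fix a countably infinite set $\mathsf{AF}$ of atomic formulas. The set $\mathsf{FOR}$ of SCI-formulas is given by $\varphi ::= p \mid \neg\varphi \mid \varphi\to\varphi \mid \varphi\equiv\varphi$ with $p\in\mathsf{AF}$. An SCI-model is a structure $\mathcal{M}=\langle U,D,\tilde\neg,\tilde\to,\tilde\equiv\rangle$ where $U\neq\emptyset$, $D\subseteq U$, $\tilde\neg:U\to U$, $\tilde\to,\tilde\equiv:U\times U\to U$, such that for all $a,b\in U$: $\tilde\neg a\in D$ iff $a\notin D$; $a\tilde\to b\in D$ iff $a\notin D$ or $b\in D$; $a\tilde\equiv b\in D$ iff $a=b$. A valuation in $\mathcal{M}$ is a map $V:\mathsf{FOR}\to U$ with $V(\neg\varphi)=\tilde\neg V(\varphi)$, $V(\varphi\to\psi)=V(\varphi)\tilde\to V(\psi)$, $V(\varphi\equiv\psi)=V(\varphi)\tilde\equiv V(\psi)$. A formula $\varphi$ is satisfied by $\mathcal{M},V$ if $V(\varphi)\in D$; valid if satisfied in every SCI-model by every valuation. Tableau system $\mathsf{TC}_{\mathsf{SCI}}$. Let $\mathsf{L}^+,\mathsf{L}^-$ be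 disjoint countably infinite sets of labels, $\mathsf{L}=\mathsf{L}^+\cup\mathsf{L}^-$; a label written $w^+$ lies in $\mathsf{L}^+$, $w^-$ in $\mathsf{L}^-$, an unsuperscripted label is arbitrary. A labelled formula is $w:\varphi$ with $w\in\mathsf{L},\varphi\in\mathsf{FOR}$. Equality statements $w=v$ and inequality statements $w\neq v$ may also occur. A tableau is a tree whose nodes carry labelled formulas, (in)equality statements or $\bot$; a branch is a root-to-leaf path, identified with the set of items on it. Rules (premises / alternative conclusion sets separated by $\mid$): Decomposition rules (all labels in the conclusions are fresh on the branch): $(\neg^+)$ $w^+:\neg\varphi$ / $v^-:\varphi$; $(\neg^-)$ $w^-:\neg\varphi$ / $v^+:\varphi$; $(\to^+)$ $w^+:\varphi\to\psi$ / $\{v^-:\varphi,u^-:\psi\}\mid\{v^-:\varphi,u^+:\psi\}\mid\{v^+:\varphi,u^+:\psi\}$; $(\to^-)$ $w^-:\varphi\to\psi$ / $\{v^+:\varphi,u^-:\psi\}$; $(\equiv^+)$ $w^+:\varphi\equiv\psi$ / $\{v^+:\varphi,u^+:\psi,v^+=u^+\}\mid\{v^-:\varphi,u^-:\psi,v^-=u^-\}$; $(\equiv^-)$ $w^-:\varphi\equiv\psi$ / $\{v^+:\varphi,u^+:\psi,v^+\neq u^+\}\mid\{v^+:\varphi,u^-:\psi\}\mid\{v^-:\varphi,u^+:\psi\}\mid\{v^-:\varphi,u^-:\psi,v^-\neq u^-\}$. Equality rules, where $\varphi\approx\psi$ abbreviates the three premises $w:\varphi$, $v:\psi$, $w=v$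 for some labels $w,v$: $(\equiv^\neg)$ $\varphi\approx\psi$, $u:\neg\varphi$, $y:\neg\psi$ / $u=y$; $(\equiv^\to)$ $\varphi\approx\psi$, $\chi\approx\theta$, $x:\varphi\to\chi$, $z:\psi\to\theta$ / $x=z$; $(\equiv^\equiv)$ $\varphi\approx\psi$, $\chi\approx\theta$, $x:\varphi\equiv\chi$, $z:\psi\equiv\theta$ / $x=z$; $(\mathsf F)$ $w:\varphi$, $v:\varphi$ / $w=v$; $(\mathsf{sym})$ $w=v$ / $v=w$; $(\mathsf{tran})$ $w=v$, $v=u$ / $w=u$. Closure rules: $(\bot_1)$ $w=v$, $w\neq v$ / $\bot$; $(\bot_2)$ $w^+=v^-$ / $\bot$. A decomposition rule may be applied to $w:\varphi$ on a branch only if it has not been applied to $w:\varphi$ on that branch before; an equality rule may be applied only if its conclusion is not already on the branch. Closure rules are applied eagerly. A branch is closed if a closure rule has been applied on it, open otherwise; a tableau is closed if all its branches are closed. A tableau proof of $\varphi$ is a closed tableau with $w^-:\varphi$ at its root. -}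

module Defs where

open import Data.Nat using (ℕ)
open import Data.Product using (_×_; _,_; Σ; ∃)
open import Data.Sum using (_⊎_)
open import Data.List using (List; []; _∷_; _++_; concatMap)
open import Data.List.Membership.Propositional using (_∈_; _∉_)
open import Data.List.Relation.Unary.All using (All)
open import Relation.Nullary using (¬_)
open import Relation.Binary.PropositionalEquality using (_≡_; _≢_)
open import Function.Bundles using (_⇔_)

infixr 6 _⇒_
infix 7 _≡'_
data Fm : Set where
  atom : ℕ → Fm
  ¬'_  : Fm → Fm
  _⇒_  : Fm → Fm → Fm
  _≡'_ : Fm → Fm → Fm

record Model : Set₁ where
  field
    U     : Set
    inhab : U
    D     : U → Set
    neg   : U → U
    imp   : U → U → U
    eqv   : U → U → U
    neg-D : ∀ a → D (neg a) ⇔ (¬ D a)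
    imp-D : ∀ a b → D (imp a b) ⇔ ((¬ D a) ⊎ D b)
    eqv-D : ∀ a b → D (eqv a b) ⇔ (a ≡ b)

record Valuation (M : Model) : Set where
  open Model M
  field
    V     : Fm → U
    V-neg : ∀ φ → V (¬' φ) ≡ neg (V φ)
    V-imp : ∀ φ ψ → V (φ ⇒ ψ) ≡ imp (V φ) (V ψ)
    V-eqv : ∀ φ ψ → V (φ ≡' ψ) ≡ eqv (V φ) (V ψ)

Satisfies : (M : Model) → Valuation M → Fm → Set
Satisfies M v φ = Model.D M (Valuation.V v φ)

Valid : Fm → Set₁
Valid φ = (M : Model) (v : Valuation M) → Satisfies M v φ

-- Labels: L⁺ = {pos} × ℕ, L⁻ = {neg} × ℕ (disjoint, countably infinite)

data Sign : Set where
  pos neg : Sign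

Label : Set
Label = Sign × ℕ

data Item : Set where
  lf   : Label → Fm → Item
  eq   : Label → Label → Item
  neq  : Label → Label → Item

Branch : Set
Branch = List Item

labelsOf : Item → List Label
labelsOf (lf w _)  = w ∷ []
labelsOf (eq w v)  = w ∷ v ∷ []
labelsOf (neq w v) = w ∷ v ∷ []

Fresh : Label → Branch → Set
Fresh l B = l ∉ concatMap labelsOf B

Fresh2 : Label → Label → Branch → Set
Fresh2 v u B = Fresh v B × Fresh u B × v ≢ u

Closable : Branch → Set
Closable B =
  (Σ Label λ w → Σ Label λ v → (eq w v ∈ B) × (neq w v ∈ B))
  ⊎ (Σ ℕ λ n → Σ ℕ λ m → eq (pos , n) (neg , m) ∈ B)

-- Decomposition rules: DecInst B w φ alts  means that a decomposition
-- rule applied to w:φ on branch B (with fresh labels) yields the list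
-- of alternative conclusion sets alts.

data DecInst (B : Branch) : Label → Fm → List (List Item) → Set where
  ¬⁺ : ∀ {n k φ} → Fresh (neg , k) B →
       DecInst B (pos , n) (¬' φ) ((lf (neg , k) φ ∷ []) ∷ [])
  ¬⁻ : ∀ {n k φ} → Fresh (pos , k) B →
       DecInst B (neg , n) (¬' φ) ((lf (pos , k) φ ∷ []) ∷ [])
  ⇒⁺ : ∀ {n φ ψ a₁ b₁ a₂ b₂ a₃ b₃} →
       Fresh2 (neg , a₁) (neg , b₁) B →
       Fresh2 (neg , a₂) (pos , b₂) B →
       Fresh2 (pos , a₃) (pos , b₃) B →
       DecInst B (pos , n) (φ ⇒ ψ)
         ((lf (neg , a₁) φ ∷ lf (neg , b₁) ψ ∷ [])
        ∷ (lf (neg , a₂) φ ∷ lf (pos , b₂) ψ ∷ [])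
        ∷ (lf (pos , a₃) φ ∷ lf (pos , b₃) ψ ∷ [])
        ∷ [])
  ⇒⁻ : ∀ {n φ ψ a b} →
       Fresh2 (pos , a) (neg , b) B →
       DecInst B (neg , n) (φ ⇒ ψ)
         ((lf (pos , a) φ ∷ lf (neg , b) ψ ∷ []) ∷ [])
  ≡⁺ : ∀ {n φ ψ a₁ b₁ a₂ b₂} →
       Fresh2 (pos , a₁) (pos , b₁) B →
       Fresh2 (neg , a₂) (neg , b₂) B →
       DecInst B (pos , n) (φ ≡' ψ)
         ((lf (pos , a₁) φ ∷ lf (pos , b₁) ψ ∷ eq (pos , a₁) (pos , b₁) ∷ [])
        ∷ (lf (neg , a₂) φ ∷ lf (neg , b₂) ψ ∷ eq (neg , a₂) (neg , b₂) ∷ [])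
        ∷ [])
  ≡⁻ : ∀ {n φ ψ a₁ b₁ a₂ b₂ a₃ b₃ a₄ b₄} →
       Fresh2 (pos , a₁) (pos , b₁) B →
       Fresh2 (pos , a₂) (neg , b₂) B →
       Fresh2 (neg , a₃) (pos , b₃) B →
       Fresh2 (neg , a₄) (neg , b₄) B →
       DecInst B (neg , n) (φ ≡' ψ)
         ((lf (pos , a₁) φ ∷ lf (pos , b₁) ψ ∷ neq (pos , a₁) (pos , b₁) ∷ [])
        ∷ (lf (pos , a₂) φ ∷ lf (neg , b₂) ψ ∷ [])
        ∷ (lf (neg , a₃) φ ∷ lf (pos , b₃) ψ ∷ [])
        ∷ (lf (neg , a₄) φ ∷ lf (neg , b₄) ψ ∷ neq (neg , a₄) (neg , b₄) ∷ [])
        ∷ [])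

_≈[_]_ : Fm → Branch → Fm → Set
φ ≈[ B ] ψ = Σ Label λ w → Σ Label λ v →
  (lf w φ ∈ B) × (lf v ψ ∈ B) × (eq w v ∈ B)

data EqInst (B : Branch) : Label → Label → Set where
  ≡¬   : ∀ {φ ψ u y} → φ ≈[ B ] ψ → lf u (¬' φ) ∈ B → lf y (¬' ψ) ∈ B →
         EqInst B u y
  ≡⇒   : ∀ {φ ψ χ θ x z} → φ ≈[ B ] ψ → χ ≈[ B ] θ →
         lf x (φ ⇒ χ) ∈ B → lf z (ψ ⇒ θ) ∈ B → EqInst B x z
  ≡≡   : ∀ {φ ψ χ θ x z} → φ ≈[ B ] ψ → χ ≈[ B ] θ →
         lf x (φ ≡' χ) ∈ B → lf z (ψ ≡' θ) ∈ B → EqInst B x z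
  F    : ∀ {φ w v} → lf w φ ∈ B → lf v φ ∈ B → EqInst B w v
  sym  : ∀ {w v} → eq w v ∈ B → EqInst B v w
  tran : ∀ {w v u} → eq w v ∈ B → eq v u ∈ B → EqInst B w u

-- Closed B used : there is a closed tableau extending the branch B,
-- where  used  records the labelled formulas to which a decomposition
-- rule has already been applied on this branch.  Closure rules are
-- applied eagerly: other rules may be applied only to non-closable
-- branches.

data Closed (B : Branch) (used : List (Label × Fm)) : Set where
  close : Closable B → Closed B used
  dec   : ∀ {w φ alts} → ¬ Closable B →
          lf w φ ∈ B → (w , φ) ∉ used → DecInst B w φ alts →
          All (λ alt → Closed (alt ++ B) ((w , φ) ∷ used)) alts →
          Closed B used
  eqr   : ∀ {w v} → ¬ Closable B →
          EqInst B w v → eq w v ∉ B →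
          Closed (eq w v ∷ B) used → Closed B used

TableauProof : Fm → Set
TableauProof φ = Σ ℕ λ k → Closed (lf (neg , k) φ ∷ []) []

{-# OPTIONS --safe #-}
module Submission where

-- Every labelled formula on a branch is decomposed exactly once (a worklist whose total
-- formula size decreases), and then equality rules are applied while they add a new
-- equality between two of the finitely many labels. A branch that still does not close
-- is open, fully expanded and saturated under the equality rules, and it yields a
-- countermodel: the universe consists of the equality classes of its labels plus free
-- terms over them; an operation applied to classes returns the class of a matching
-- compound formula on the branch if there is one (well defined by the congruence rules)
-- and a free term otherwise; a class is designated iff its labels are positive (well
-- defined because no positive label is equated with a negative one). Every formula on
-- the branch evaluates to the class of its label, so the negatively labelled root is
-- false in this model, contradicting validity.

open import Defs
open import Data.Empty using (⊥; ⊥-elim)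
open import Data.List using (List; []; _∷_; _++_; map; concatMap; cartesianProduct; find)
open import Data.List.Extrema.Nat using (max; xs≤max)
open import Data.List.Membership.Propositional using (_∈_; _∉_; lose) renaming (find to find-∈)
open import Data.List.Membership.Propositional.Properties
  using (∈-map⁺; ∈-++⁺ˡ; ∈-++⁺ʳ; ∈-++⁻; ∈-concatMap⁺; ∈-concatMap⁻; ∈-cartesianProduct⁺)
open import Data.List.Relation.Binary.Subset.Propositional using (_⊆_)
open import Data.List.Relation.Unary.All as All using (All; []; _∷_)
open import Data.List.Relation.Unary.Any using (Any; here; there; any?)
open import Data.Maybe using (just; fromMaybe)
open import Data.Nat using (ℕ; suc; _+_; _≤_; _<_; z≤n; s≤s; s≤s⁻¹)
open import Data.Nat.Properties
  using ( ≤-refl; ≤-reflexive; n≤1+n; n<1+n; m≤n⇒m≤1+n; <⇒≱; <-≤-trans; m<n+m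
        ; +-monoˡ-<; +-identityʳ; +-assoc; 1+n≢n)
  renaming (_≟_ to _≟ⁿ_)
open import Data.Product using (∃; ∃₂; _×_; _,_; proj₁; proj₂)
open import Data.Product.Properties using (≡-dec)
open import Data.Sum using (_⊎_; inj₁; inj₂; map₂)
open import Data.Unit using (⊤; tt)
open import Function using (_∘_)
open import Function.Bundles using (_⇔_; mk⇔; Equivalence)
open import Function.Construct.Identity using (⇔-id)
open import Relation.Binary.Definitions using (DecidableEquality)
open import Relation.Binary.PropositionalEquality
  using (_≡_; _≢_; refl; cong; cong₂; subst) renaming (sym to ≡-sym; trans to ≡-trans)
open import Relation.Nullary using (¬_; Dec; yes; no)
open import Relation.Nullary.Decidable using (map′; ¬?; _×-dec_; _⊎-dec_)
open import Relation.Unary using (Decidable)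

_≟ˢ_ : DecidableEquality Sign
pos ≟ˢ pos = yes refl
pos ≟ˢ neg = no λ ()
neg ≟ˢ pos = no λ ()
neg ≟ˢ neg = yes refl

_≟ˡ_ : DecidableEquality Label
_≟ˡ_ = ≡-dec _≟ˢ_ _≟ⁿ_

_≟ᶠ_ : DecidableEquality Fm
atom p ≟ᶠ atom q = map′ (cong atom) (λ { refl → refl }) (p ≟ⁿ q)
(¬' φ) ≟ᶠ (¬' ψ) = map′ (cong ¬'_) (λ { refl → refl }) (φ ≟ᶠ ψ)
(φ ⇒ ψ) ≟ᶠ (χ ⇒ θ) =
  map′ (λ { (refl , refl) → refl }) (λ { refl → refl , refl }) (φ ≟ᶠ χ ×-dec ψ ≟ᶠ θ)
(φ ≡' ψ) ≟ᶠ (χ ≡' θ) =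
  map′ (λ { (refl , refl) → refl }) (λ { refl → refl , refl }) (φ ≟ᶠ χ ×-dec ψ ≟ᶠ θ)
atom _ ≟ᶠ (¬' _) = no λ ()
atom _ ≟ᶠ (_ ⇒ _) = no λ ()
atom _ ≟ᶠ (_ ≡' _) = no λ ()
(¬' _) ≟ᶠ atom _ = no λ ()
(¬' _) ≟ᶠ (_ ⇒ _) = no λ ()
(¬' _) ≟ᶠ (_ ≡' _) = no λ ()
(_ ⇒ _) ≟ᶠ atom _ = no λ ()
(_ ⇒ _) ≟ᶠ (¬' _) = no λ ()
(_ ⇒ _) ≟ᶠ (_ ≡' _) = no λ ()
(_ ≡' _) ≟ᶠ atom _ = no λ ()
(_ ≡' _) ≟ᶠ (¬' _) = no λ ()
(_ ≡' _) ≟ᶠ (_ ⇒ _) = no λ ()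

_≟ⁱ_ : DecidableEquality Item
lf w φ ≟ⁱ lf v ψ =
  map′ (λ { (refl , refl) → refl }) (λ { refl → refl , refl }) (w ≟ˡ v ×-dec φ ≟ᶠ ψ)
eq w u ≟ⁱ eq v y =
  map′ (λ { (refl , refl) → refl }) (λ { refl → refl , refl }) (w ≟ˡ v ×-dec u ≟ˡ y)
neq w u ≟ⁱ neq v y =
  map′ (λ { (refl , refl) → refl }) (λ { refl → refl , refl }) (w ≟ˡ v ×-dec u ≟ˡ y)
lf _ _ ≟ⁱ eq _ _ = no λ ()
lf _ _ ≟ⁱ neq _ _ = no λ ()
eq _ _ ≟ⁱ lf _ _ = no λ ()
eq _ _ ≟ⁱ neq _ _ = no λ ()
neq _ _ ≟ⁱ lf _ _ = no λ ()
neq _ _ ≟ⁱ eq _ _ = no λ ()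

open import Data.List.Membership.DecPropositional _≟ⁱ_ using (_∈?_)
open import Data.List.Membership.DecPropositional (≡-dec _≟ˡ_ _≟ᶠ_) using ()
  renaming (_∈?_ to _∈ˡᶠ?_)

bounded-∃? : ∀ {A : Set} {P : A → Set} (xs : List A) → Decidable P →
             (∀ {x} → P x → x ∈ xs) → Dec (∃ P)
bounded-∃? xs P? bound =
  map′ (λ a → let x , _ , p = find-∈ a in x , p) (λ (x , p) → lose (bound p) p) (any? P? xs)

find-just : ∀ {A : Set} {P : A → Set} (P? : Decidable P) {xs} →
            Any P xs → ∃ λ y → find P? xs ≡ just y × P y
find-just P? {x ∷ xs} a with P? x | a
... | yes p | _ = x , refl , p
... | no ¬p | here p = ⊥-elim (¬p p)
... | no _ | there a′ = find-just P? a′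

find-cong : ∀ {A : Set} {P Q : A → Set} (P? : Decidable P) (Q? : Decidable Q) →
            (∀ {x} → P x → Q x) → (∀ {x} → Q x → P x) → ∀ xs → find P? xs ≡ find Q? xs
find-cong P? Q? P⇒Q Q⇒P [] = refl
find-cong P? Q? P⇒Q Q⇒P (x ∷ xs) with P? x | Q? x
... | yes _ | yes _ = refl
... | no _ | no _ = find-cong P? Q? P⇒Q Q⇒P xs
... | yes p | no ¬q = ⊥-elim (¬q (P⇒Q p))
... | no ¬p | yes q = ⊥-elim (¬p (Q⇒P q))

labs : Branch → List Label
labs = concatMap labelsOf

labelledOf : Item → List (Label × Fm)
labelledOf (lf w φ) = (w , φ) ∷ []
labelledOf (eq _ _) = []
labelledOf (neq _ _) = []

labelled : Branch → List (Label × Fm)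
labelled = concatMap labelledOf

formulas : Branch → List Fm
formulas = map proj₂ ∘ labelled

module _ {B : Branch} where

  ∈⇒label∈labs : ∀ {x l} → x ∈ B → l ∈ labelsOf x → l ∈ labs B
  ∈⇒label∈labs x∈B l∈x = ∈-concatMap⁺ labelsOf (lose x∈B l∈x)

  lf∈⇒label∈labs : ∀ {w φ} → lf w φ ∈ B → w ∈ labs B
  lf∈⇒label∈labs m = ∈⇒label∈labs m (here refl)

  lf∈⇒∈labelled : ∀ {w φ} → lf w φ ∈ B → (w , φ) ∈ labelled B
  lf∈⇒∈labelled m = ∈-concatMap⁺ labelledOf (lose m (here refl))

  ∈labelled⇒lf∈ : ∀ {w φ} → (w , φ) ∈ labelled B → lf w φ ∈ B
  ∈labelled⇒lf∈ m with find-∈ (∈-concatMap⁻ labelledOf {xs = B} m)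
  ... | lf _ _ , x∈B , here refl = x∈B

  lf∈⇒∈formulas : ∀ {w φ} → lf w φ ∈ B → φ ∈ formulas B
  lf∈⇒∈formulas m = ∈-map⁺ proj₂ (lf∈⇒∈labelled m)

fresh : Branch → ℕ
fresh B = suc (max 0 (map proj₂ (labs B)))

fresh-Fresh : ∀ B {k} s → fresh B ≤ k → Fresh (s , k) B
fresh-Fresh B s fresh≤k m =
  <⇒≱ fresh≤k (All.lookup (xs≤max 0 (map proj₂ (labs B))) (∈-map⁺ proj₂ m))

fresh-Fresh2 : ∀ B s t → Fresh2 (s , fresh B) (t , suc (fresh B)) B
fresh-Fresh2 B s t =
  fresh-Fresh B s ≤-refl , fresh-Fresh B t (n≤1+n _) , 1+n≢n ∘ ≡-sym ∘ cong proj₂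

closable? : ∀ B → Dec (Closable B)
closable? B = clash? ⊎-dec polarity-clash?
  where
  clash? = bounded-∃? (labs B)
    (λ w → bounded-∃? (labs B) (λ v → eq w v ∈? B ×-dec neq w v ∈? B)
      (λ (m , _) → ∈⇒label∈labs m (there (here refl))))
    (λ (_ , m , _) → ∈⇒label∈labs m (here refl))
  polarity-clash? = bounded-∃? (map proj₂ (labs B))
    (λ n → bounded-∃? (map proj₂ (labs B)) (λ k → eq (pos , n) (neg , k) ∈? B)
      (λ m → ∈-map⁺ proj₂ (∈⇒label∈labs m (there (here refl)))))
    (λ (_ , m) → ∈-map⁺ proj₂ (∈⇒label∈labs m (here refl)))

sgn : Label → Sign
sgn = proj₁

negˢ : Sign → Sign
negˢ pos = neg
negˢ neg = pos

_⇒ˢ_ : Sign → Sign → Sign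
pos ⇒ˢ t = t
neg ⇒ˢ _ = pos

Holds : Sign → Set
Holds pos = ⊤
Holds neg = ⊥

Holds-negˢ : ∀ s → Holds (negˢ s) ⇔ (¬ Holds s)
Holds-negˢ pos = mk⇔ ⊥-elim (λ ¬⊤ → ¬⊤ tt)
Holds-negˢ neg = mk⇔ (λ _ ()) (λ _ → tt)

Holds-⇒ˢ : ∀ s t → Holds (s ⇒ˢ t) ⇔ (¬ Holds s ⊎ Holds t)
Holds-⇒ˢ pos t = mk⇔ inj₂ λ { (inj₁ ¬⊤) → ⊥-elim (¬⊤ tt) ; (inj₂ h) → h }
Holds-⇒ˢ neg t = mk⇔ (λ _ → inj₁ λ ()) (λ _ → tt)

EquivalenceWitness : Branch → Sign → Label → Label → Set
EquivalenceWitness B pos v u = eq v u ∈ B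
EquivalenceWitness B neg v u = sgn v ≢ sgn u ⊎ neq v u ∈ B

Expanded : Branch → Label → Fm → Set
Expanded B w (atom _) = ⊤
Expanded B w (¬' φ) = ∃ λ v → lf v φ ∈ B × sgn w ≡ negˢ (sgn v)
Expanded B w (φ ⇒ ψ) = ∃₂ λ v u → lf v φ ∈ B × lf u ψ ∈ B × sgn w ≡ sgn v ⇒ˢ sgn u
Expanded B w (φ ≡' ψ) = ∃₂ λ v u → lf v φ ∈ B × lf u ψ ∈ B × EquivalenceWitness B (sgn w) v u

Expanded-mono : ∀ {B B′} w φ → B ⊆ B′ → Expanded B w φ → Expanded B′ w φ
Expanded-mono w (atom _) sub _ = tt
Expanded-mono w (¬' φ) sub (v , mv , s) = v , sub mv , s
Expanded-mono w (φ ⇒ ψ) sub (v , u , mv , mu , s) = v , u , sub mv , sub mu , s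
Expanded-mono (pos , _) (φ ≡' ψ) sub (v , u , mv , mu , e) = v , u , sub mv , sub mu , sub e
Expanded-mono (neg , _) (φ ≡' ψ) sub (v , u , mv , mu , d) = v , u , sub mv , sub mu , map₂ sub d

FullyExpanded : Branch → Set
FullyExpanded B = ∀ {w φ} → lf w φ ∈ B → Expanded B w φ

split : Sign → Sign → Fm → Fm → ℕ → List Item
split s t φ ψ c = lf (s , c) φ ∷ lf (t , suc c) ψ ∷ []

branches : Sign → Fm → ℕ → List (List Item)
branches _ (atom _) c = []
branches pos (¬' φ) c = (lf (neg , c) φ ∷ []) ∷ []
branches neg (¬' φ) c = (lf (pos , c) φ ∷ []) ∷ []
branches pos (φ ⇒ ψ) c = split neg neg φ ψ c ∷ split neg pos φ ψ c ∷ split pos pos φ ψ c ∷ []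
branches neg (φ ⇒ ψ) c = split pos neg φ ψ c ∷ []
branches pos (φ ≡' ψ) c =
    (split pos pos φ ψ c ++ eq (pos , c) (pos , suc c) ∷ [])
  ∷ (split neg neg φ ψ c ++ eq (neg , c) (neg , suc c) ∷ [])
  ∷ []
branches neg (φ ≡' ψ) c =
    (split pos pos φ ψ c ++ neq (pos , c) (pos , suc c) ∷ [])
  ∷ split pos neg φ ψ c
  ∷ split neg pos φ ψ c
  ∷ (split neg neg φ ψ c ++ neq (neg , c) (neg , suc c) ∷ [])
  ∷ []

rule : ∀ B w φ → Expanded B w φ ⊎ DecInst B w φ (branches (sgn w) φ (fresh B))
rule B w (atom _) = inj₁ tt
rule B (pos , _) (¬' φ) = inj₂ (¬⁺ (fresh-Fresh B neg ≤-refl))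
rule B (neg , _) (¬' φ) = inj₂ (¬⁻ (fresh-Fresh B pos ≤-refl))
rule B (pos , _) (φ ⇒ ψ) =
  inj₂ (⇒⁺ (fresh-Fresh2 B neg neg) (fresh-Fresh2 B neg pos) (fresh-Fresh2 B pos pos))
rule B (neg , _) (φ ⇒ ψ) = inj₂ (⇒⁻ (fresh-Fresh2 B pos neg))
rule B (pos , _) (φ ≡' ψ) = inj₂ (≡⁺ (fresh-Fresh2 B pos pos) (fresh-Fresh2 B neg neg))
rule B (neg , _) (φ ≡' ψ) =
  inj₂ (≡⁻ (fresh-Fresh2 B pos pos) (fresh-Fresh2 B pos neg) (fresh-Fresh2 B neg pos)
           (fresh-Fresh2 B neg neg))

branches-expand : ∀ w φ c → All (λ alt → ∀ B → Expanded (alt ++ B) w φ) (branches (sgn w) φ c)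
branches-expand w (atom _) c = []
branches-expand (pos , _) (¬' φ) c = (λ _ → _ , here refl , refl) ∷ []
branches-expand (neg , _) (¬' φ) c = (λ _ → _ , here refl , refl) ∷ []
branches-expand (pos , _) (φ ⇒ ψ) c =
    (λ _ → _ , _ , here refl , there (here refl) , refl)
  ∷ (λ _ → _ , _ , here refl , there (here refl) , refl)
  ∷ (λ _ → _ , _ , here refl , there (here refl) , refl)
  ∷ []
branches-expand (neg , _) (φ ⇒ ψ) c = (λ _ → _ , _ , here refl , there (here refl) , refl) ∷ []
branches-expand (pos , _) (φ ≡' ψ) c =
    (λ _ → _ , _ , here refl , there (here refl) , there (there (here refl)))
  ∷ (λ _ → _ , _ , here refl , there (here refl) , there (there (here refl)))
  ∷ []
branches-expand (neg , _) (φ ≡' ψ) c =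
    (λ _ → _ , _ , here refl , there (here refl) , inj₂ (there (there (here refl))))
  ∷ (λ _ → _ , _ , here refl , there (here refl) , inj₁ λ ())
  ∷ (λ _ → _ , _ , here refl , there (here refl) , inj₁ λ ())
  ∷ (λ _ → _ , _ , here refl , there (here refl) , inj₂ (there (there (here refl))))
  ∷ []

size : Fm → ℕ
size (atom _) = 1
size (¬' φ) = suc (size φ)
size (φ ⇒ ψ) = suc (size φ + size ψ)
size (φ ≡' ψ) = suc (size φ + size ψ)

0<size : ∀ φ → 0 < size φ
0<size (atom _) = s≤s z≤n
0<size (¬' _) = s≤s z≤n
0<size (_ ⇒ _) = s≤s z≤n
0<size (_ ≡' _) = s≤s z≤n

weight : List (Label × Fm) → ℕ
weight [] = 0
weight ((_ , φ) ∷ ps) = size φ + weight ps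

weight-++ : ∀ ps qs → weight (ps ++ qs) ≡ weight ps + weight qs
weight-++ [] qs = refl
weight-++ ((_ , φ) ∷ ps) qs =
  ≡-trans (cong (size φ +_) (weight-++ ps qs)) (≡-sym (+-assoc (size φ) _ _))

weight-tail : ∀ {n} φ todo → size φ + weight todo < suc n → weight todo < n
weight-tail φ todo lt = <-≤-trans (m<n+m (weight todo) (0<size φ)) (s≤s⁻¹ lt)

weight-replace : ∀ {n} φ ps todo → weight ps < size φ → size φ + weight todo < suc n →
                 weight (ps ++ todo) < n
weight-replace {n} φ ps todo lighter lt =
  subst (_< n) (≡-sym (weight-++ ps todo))
    (<-≤-trans (+-monoˡ-< (weight todo) lighter) (s≤s⁻¹ lt))

m+0<1+m : ∀ m → m + 0 < suc m
m+0<1+m m = s≤s (≤-reflexive (+-identityʳ m))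

m+[n+0]<1+m+n : ∀ m n → m + (n + 0) < suc (m + n)
m+[n+0]<1+m+n m n = s≤s (≤-reflexive (cong (m +_) (+-identityʳ n)))

branches-lighter : ∀ s φ c → All (λ alt → weight (labelled alt) < size φ) (branches s φ c)
branches-lighter _ (atom _) c = []
branches-lighter pos (¬' φ) c = m+0<1+m (size φ) ∷ []
branches-lighter neg (¬' φ) c = m+0<1+m (size φ) ∷ []
branches-lighter pos (φ ⇒ ψ) c = lighter ∷ lighter ∷ lighter ∷ []
  where lighter = m+[n+0]<1+m+n (size φ) (size ψ)
branches-lighter neg (φ ⇒ ψ) c = m+[n+0]<1+m+n (size φ) (size ψ) ∷ []
branches-lighter pos (φ ≡' ψ) c = lighter ∷ lighter ∷ []
  where lighter = m+[n+0]<1+m+n (size φ) (size ψ)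
branches-lighter neg (φ ≡' ψ) c = lighter ∷ lighter ∷ lighter ∷ lighter ∷ []
  where lighter = m+[n+0]<1+m+n (size φ) (size ψ)

record Agenda (B : Branch) (used todo : List (Label × Fm)) : Set where
  field
    scheduled : ∀ {w φ} → (w , φ) ∈ todo → lf w φ ∈ B
    covered : ∀ {w φ} → lf w φ ∈ B → (w , φ) ∈ todo ⊎ Expanded B w φ
    done : ∀ {w φ} → (w , φ) ∈ used → Expanded B w φ
open Agenda

Agenda-root : ∀ w φ → Agenda (lf w φ ∷ []) [] ((w , φ) ∷ [])
Agenda-root w φ = record
  { scheduled = λ { (here refl) → here refl }
  ; covered = λ { (here refl) → inj₁ (here refl) }
  ; done = λ ()
  }

Agenda-skip : ∀ {B used w φ todo} → Agenda B used ((w , φ) ∷ todo) → Expanded B w φ →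
              Agenda B used todo
Agenda-skip {B} {used} {w} {φ} {todo} ag ex = record
  { scheduled = scheduled ag ∘ there
  ; covered = covered′
  ; done = done ag
  }
  where
  covered′ : ∀ {v ψ} → lf v ψ ∈ B → (v , ψ) ∈ todo ⊎ Expanded B v ψ
  covered′ m with covered ag m
  ... | inj₁ (here refl) = inj₂ ex
  ... | inj₁ (there m′) = inj₁ m′
  ... | inj₂ e = inj₂ e

Agenda-branch : ∀ {B used w φ todo} alt → Agenda B used ((w , φ) ∷ todo) →
                (∀ B′ → Expanded (alt ++ B′) w φ) →
                Agenda (alt ++ B) ((w , φ) ∷ used) (labelled alt ++ todo)
Agenda-branch {B} {used} {w} {φ} {todo} alt ag ex = record
  { scheduled = scheduled′
  ; covered = covered′
  ; done = λ { (here refl) → ex B ; (there m) → Expanded-mono _ _ (∈-++⁺ʳ alt) (done ag m) }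
  }
  where
  scheduled′ : ∀ {v ψ} → (v , ψ) ∈ labelled alt ++ todo → lf v ψ ∈ alt ++ B
  scheduled′ m with ∈-++⁻ (labelled alt) m
  ... | inj₁ m′ = ∈-++⁺ˡ (∈labelled⇒lf∈ {alt} m′)
  ... | inj₂ m′ = ∈-++⁺ʳ alt (scheduled ag (there m′))
  covered′ : ∀ {v ψ} → lf v ψ ∈ alt ++ B →
             (v , ψ) ∈ labelled alt ++ todo ⊎ Expanded (alt ++ B) v ψ
  covered′ m with ∈-++⁻ alt m
  ... | inj₁ m′ = inj₁ (∈-++⁺ˡ (lf∈⇒∈labelled {alt} m′))
  ... | inj₂ m′ with covered ag m′
  ...   | inj₁ (here refl) = inj₂ (ex B)
  ...   | inj₁ (there m″) = inj₁ (∈-++⁺ʳ (labelled alt) m″)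
  ...   | inj₂ e = inj₂ (Expanded-mono _ _ (∈-++⁺ʳ alt) e)

Agenda-complete : ∀ {B used} → Agenda B used [] → FullyExpanded B
Agenda-complete ag m with covered ag m
... | inj₂ e = e

expand : ∀ n {B used todo} → weight todo < n → Agenda B used todo →
         (∀ {B′} used′ → B ⊆ B′ → FullyExpanded B′ → Closed B′ used′) → Closed B used
expand (suc n) {todo = []} _ ag k = k _ (λ m → m) (Agenda-complete ag)
expand (suc n) {B} {used} {(w , φ) ∷ todo} lt ag k
  with closable? B | (w , φ) ∈ˡᶠ? used | rule B w φ
... | yes cl | _ | _ = close cl
... | no _ | yes u | _ = expand n (weight-tail φ todo lt) (Agenda-skip ag (done ag u)) k
... | no _ | no _ | inj₁ ex = expand n (weight-tail φ todo lt) (Agenda-skip ag ex) k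
... | no not-closable | no unused | inj₂ r =
  dec not-closable (scheduled ag (here refl)) unused r
    (All.zipWith continue (branches-expand w φ (fresh B) , branches-lighter (sgn w) φ (fresh B)))
  where
  continue : ∀ {alt} → (∀ B′ → Expanded (alt ++ B′) w φ) × weight (labelled alt) < size φ →
             Closed (alt ++ B) ((w , φ) ∷ used)
  continue {alt} (ex , lighter) =
    expand n (weight-replace φ (labelled alt) todo lighter lt) (Agenda-branch alt ag ex)
      (λ used′ sub → k used′ (sub ∘ ∈-++⁺ʳ alt))

EqSaturated : Branch → Set
EqSaturated B = ∀ {w v} → EqInst B w v → eq w v ∈ B

module _ (B : Branch) where

  ≈-left : ∀ {φ ψ} → φ ≈[ B ] ψ → φ ∈ formulas B
  ≈-left (_ , _ , m , _) = lf∈⇒∈formulas m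

  ≈-right : ∀ {φ ψ} → φ ≈[ B ] ψ → ψ ∈ formulas B
  ≈-right (_ , _ , _ , m , _) = lf∈⇒∈formulas m

  ≈? : ∀ φ ψ → Dec (φ ≈[ B ] ψ)
  ≈? φ ψ = bounded-∃? (labs B)
    (λ w → bounded-∃? (labs B) (λ v → lf w φ ∈? B ×-dec lf v ψ ∈? B ×-dec eq w v ∈? B)
      (λ (_ , m , _) → lf∈⇒label∈labs m))
    (λ (_ , m , _) → lf∈⇒label∈labs m)

  SharedFormula : Label → Label → Set
  SharedFormula w v = ∃ λ φ → lf w φ ∈ B × lf v φ ∈ B

  Chain : Label → Label → Set
  Chain w v = ∃ λ u → eq w u ∈ B × eq u v ∈ B

  NegCongruence : Label → Label → Set
  NegCongruence u y = ∃₂ λ φ ψ → φ ≈[ B ] ψ × lf u (¬' φ) ∈ B × lf y (¬' ψ) ∈ B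

  Congruence : (Fm → Fm → Fm) → Label → Label → Set
  Congruence op x z = ∃₂ λ φ ψ → ∃₂ λ χ θ →
    φ ≈[ B ] ψ × χ ≈[ B ] θ × lf x (op φ χ) ∈ B × lf z (op ψ θ) ∈ B

  sharedFormula? : ∀ w v → Dec (SharedFormula w v)
  sharedFormula? w v =
    bounded-∃? (formulas B) (λ φ → lf w φ ∈? B ×-dec lf v φ ∈? B) (lf∈⇒∈formulas ∘ proj₁)

  chain? : ∀ w v → Dec (Chain w v)
  chain? w v = bounded-∃? (labs B) (λ u → eq w u ∈? B ×-dec eq u v ∈? B)
    (λ (m , _) → ∈⇒label∈labs m (there (here refl)))

  negCongruence? : ∀ u y → Dec (NegCongruence u y)
  negCongruence? u y = bounded-∃? (formulas B)
    (λ φ → bounded-∃? (formulas B)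
      (λ ψ → ≈? φ ψ ×-dec lf u (¬' φ) ∈? B ×-dec lf y (¬' ψ) ∈? B)
      (≈-right ∘ proj₁))
    (λ (_ , φ≈ψ , _) → ≈-left φ≈ψ)

  congruence? : ∀ op x z → Dec (Congruence op x z)
  congruence? op x z = bounded-∃? (formulas B)
    (λ φ → bounded-∃? (formulas B)
      (λ ψ → bounded-∃? (formulas B)
        (λ χ → bounded-∃? (formulas B)
          (λ θ → ≈? φ ψ ×-dec ≈? χ θ ×-dec lf x (op φ χ) ∈? B ×-dec lf z (op ψ θ) ∈? B)
          (λ (_ , χ≈θ , _) → ≈-right χ≈θ))
        (λ (_ , _ , χ≈θ , _) → ≈-left χ≈θ))
      (λ (_ , _ , φ≈ψ , _) → ≈-right φ≈ψ))
    (λ (_ , _ , _ , φ≈ψ , _) → ≈-left φ≈ψ)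

  eqInst? : ∀ w v → Dec (EqInst B w v)
  eqInst? w v
    with sharedFormula? w v | eq v w ∈? B | chain? w v | negCongruence? w v
       | congruence? _⇒_ w v | congruence? _≡'_ w v
  ... | yes (_ , m₁ , m₂) | _ | _ | _ | _ | _ = yes (F m₁ m₂)
  ... | no _ | yes m | _ | _ | _ | _ = yes (sym m)
  ... | no _ | no _ | yes (_ , m₁ , m₂) | _ | _ | _ = yes (tran m₁ m₂)
  ... | no _ | no _ | no _ | yes (_ , _ , a , m₁ , m₂) | _ | _ = yes (≡¬ a m₁ m₂)
  ... | no _ | no _ | no _ | no _ | yes (_ , _ , _ , _ , a₁ , a₂ , m₁ , m₂) | _ =
    yes (≡⇒ a₁ a₂ m₁ m₂)
  ... | no _ | no _ | no _ | no _ | no _ | yes (_ , _ , _ , _ , a₁ , a₂ , m₁ , m₂) =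
    yes (≡≡ a₁ a₂ m₁ m₂)
  ... | no ¬F | no ¬sym | no ¬tran | no ¬neg | no ¬imp | no ¬eqv = no λ where
    (F m₁ m₂) → ¬F (_ , m₁ , m₂)
    (sym m) → ¬sym m
    (tran m₁ m₂) → ¬tran (_ , m₁ , m₂)
    (≡¬ a m₁ m₂) → ¬neg (_ , _ , a , m₁ , m₂)
    (≡⇒ a₁ a₂ m₁ m₂) → ¬imp (_ , _ , _ , _ , a₁ , a₂ , m₁ , m₂)
    (≡≡ a₁ a₂ m₁ m₂) → ¬eqv (_ , _ , _ , _ , a₁ , a₂ , m₁ , m₂)

  eqInst-labels : ∀ {w v} → EqInst B w v → w ∈ labs B × v ∈ labs B
  eqInst-labels (≡¬ _ m₁ m₂) = lf∈⇒label∈labs m₁ , lf∈⇒label∈labs m₂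
  eqInst-labels (≡⇒ _ _ m₁ m₂) = lf∈⇒label∈labs m₁ , lf∈⇒label∈labs m₂
  eqInst-labels (≡≡ _ _ m₁ m₂) = lf∈⇒label∈labs m₁ , lf∈⇒label∈labs m₂
  eqInst-labels (F m₁ m₂) = lf∈⇒label∈labs m₁ , lf∈⇒label∈labs m₂
  eqInst-labels (sym m) = ∈⇒label∈labs m (there (here refl)) , ∈⇒label∈labs m (here refl)
  eqInst-labels (tran m₁ m₂) = ∈⇒label∈labs m₁ (here refl) , ∈⇒label∈labs m₂ (there (here refl))

  NewEquality : Set
  NewEquality = ∃₂ λ w v → EqInst B w v × eq w v ∉ B

  newEquality? : Dec NewEquality
  newEquality? = bounded-∃? (labs B)
    (λ w → bounded-∃? (labs B) (λ v → eqInst? w v ×-dec ¬? (eq w v ∈? B))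
      (proj₂ ∘ eqInst-labels ∘ proj₁))
    (λ (_ , ei , _) → proj₁ (eqInst-labels ei))

  saturated : ¬ NewEquality → EqSaturated B
  saturated none {w} {v} ei with eq w v ∈? B
  ... | yes m = m
  ... | no ∉B = ⊥-elim (none (w , v , ei , ∉B))

unless : ∀ {P : Set} → Dec P → ℕ → ℕ
unless (yes _) n = n
unless (no _) n = suc n

unless-mono-≤ : ∀ {P Q : Set} {m n} (P? : Dec P) (Q? : Dec Q) → (Q → P) → m ≤ n →
                unless P? m ≤ unless Q? n
unless-mono-≤ (yes _) (yes _) _ m≤n = m≤n
unless-mono-≤ (yes _) (no _) _ m≤n = m≤n⇒m≤1+n m≤n
unless-mono-≤ (no ¬p) (yes q) Q⇒P _ = ⊥-elim (¬p (Q⇒P q))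
unless-mono-≤ (no _) (no _) _ m≤n = s≤s m≤n

unless-mono-< : ∀ {P Q : Set} {m n} (P? : Dec P) (Q? : Dec Q) → (Q → P) → m < n →
                unless P? m < unless Q? n
unless-mono-< (yes _) (yes _) _ m<n = m<n
unless-mono-< (yes _) (no _) _ m<n = m≤n⇒m≤1+n m<n
unless-mono-< (no ¬p) (yes q) Q⇒P _ = ⊥-elim (¬p (Q⇒P q))
unless-mono-< (no _) (no _) _ m<n = s≤s m<n

unless-< : ∀ {P Q : Set} {m n} (P? : Dec P) (Q? : Dec Q) → P → ¬ Q → m ≤ n →
           unless P? m < unless Q? n
unless-< (yes _) (no _) _ _ m≤n = s≤s m≤n
unless-< (no ¬p) _ p _ _ = ⊥-elim (¬p p)
unless-< _ (yes q) _ ¬q _ = ⊥-elim (¬q q)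

missing : Branch → List (Label × Label) → ℕ
missing B [] = 0
missing B ((w , v) ∷ ps) = unless (eq w v ∈? B) (missing B ps)

missing-∷-≤ : ∀ x B ps → missing (x ∷ B) ps ≤ missing B ps
missing-∷-≤ x B [] = z≤n
missing-∷-≤ x B ((w , v) ∷ ps) =
  unless-mono-≤ (eq w v ∈? x ∷ B) (eq w v ∈? B) there (missing-∷-≤ x B ps)

missing-∷-< : ∀ {w v} B ps → (w , v) ∈ ps → eq w v ∉ B → missing (eq w v ∷ B) ps < missing B ps
missing-∷-< {w} {v} B (_ ∷ ps) (here refl) ∉B =
  unless-< (eq w v ∈? eq w v ∷ B) (eq w v ∈? B) (here refl) ∉B (missing-∷-≤ (eq w v) B ps)
missing-∷-< {w} {v} B ((u , y) ∷ ps) (there m) ∉B =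
  unless-mono-< (eq u y ∈? eq w v ∷ B) (eq u y ∈? B) there (missing-∷-< B ps m ∉B)

module Countermodel (B : Branch) (not-closable : ¬ Closable B) (expanded : FullyExpanded B)
                    (eq-saturated : EqSaturated B) where

  eq-sym : ∀ {w v} → eq w v ∈ B → eq v w ∈ B
  eq-sym = eq-saturated ∘ sym

  eq-trans : ∀ {w v u} → eq w v ∈ B → eq v u ∈ B → eq w u ∈ B
  eq-trans m₁ m₂ = eq-saturated (tran m₁ m₂)

  eq-F : ∀ {w v φ} → lf w φ ∈ B → lf v φ ∈ B → eq w v ∈ B
  eq-F m₁ m₂ = eq-saturated (F m₁ m₂)

  eq-sgn : ∀ {w v} → eq w v ∈ B → sgn w ≡ sgn v
  eq-sgn {pos , _} {pos , _} _ = refl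
  eq-sgn {neg , _} {neg , _} _ = refl
  eq-sgn {pos , n} {neg , k} m = ⊥-elim (not-closable (inj₂ (n , k , m)))
  eq-sgn {neg , n} {pos , k} m = ⊥-elim (not-closable (inj₂ (k , n , eq-sym m)))

  Labelled : Label → Set
  Labelled w = ∃ λ φ → lf w φ ∈ B

  canon : Label → Label
  canon w = fromMaybe w (find (λ l → eq w l ∈? B) (labs B))

  canon-found : ∀ {w} → Labelled w →
                ∃ λ c → find (λ l → eq w l ∈? B) (labs B) ≡ just c × eq w c ∈ B
  canon-found (_ , m) = find-just (λ l → eq _ l ∈? B) (lose (lf∈⇒label∈labs m) (eq-F m m))

  canon-eq : ∀ {w} → Labelled w → eq w (canon w) ∈ B
  canon-eq h with canon-found h
  ... | c , found , m rewrite found = m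

  canon-cong : ∀ {w w′} → Labelled w → eq w w′ ∈ B → canon w ≡ canon w′
  canon-cong {w} {w′} h e with canon-found h
  ... | c , found , _ =
    ≡-trans (cong (fromMaybe w) found) (cong (fromMaybe w′) (≡-trans (≡-sym found) same))
    where
    same = find-cong (λ l → eq w l ∈? B) (λ l → eq w′ l ∈? B)
                     (eq-trans (eq-sym e)) (eq-trans e) (labs B)

  canon-≡⇒eq : ∀ {w w′} → Labelled w → Labelled w′ → canon w ≡ canon w′ → eq w w′ ∈ B
  canon-≡⇒eq h h′ e =
    eq-trans (canon-eq h) (subst (λ c → eq c _ ∈ B) (≡-sym e) (eq-sym (canon-eq h′)))

  sgn-canon : ∀ {w} → Labelled w → sgn (canon w) ≡ sgn w
  sgn-canon h = ≡-sym (eq-sgn (canon-eq h))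

  ClassOf : Fm → Label → Set
  ClassOf χ l = ∃ λ w → lf w χ ∈ B × canon w ≡ l

  classOf? : ∀ χ l → Dec (ClassOf χ l)
  classOf? χ l =
    bounded-∃? (labs B) (λ w → lf w χ ∈? B ×-dec canon w ≟ˡ l) (lf∈⇒label∈labs ∘ proj₁)

  class-canon : ∀ {χ l v} → ClassOf χ l → lf v χ ∈ B → canon v ≡ l
  class-canon (_ , mw , refl) mv = ≡-sym (canon-cong (_ , mw) (eq-F mw mv))

  class-sgn : ∀ {χ l v} → ClassOf χ l → lf v χ ∈ B → sgn v ≡ sgn l
  class-sgn cl mv = ≡-trans (≡-sym (sgn-canon (_ , mv))) (cong sgn (class-canon cl mv))

  class-≈ : ∀ {χ φ v} → ClassOf χ (canon v) → lf v φ ∈ B → χ ≈[ B ] φ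
  class-≈ (w , mw , c) mv = w , _ , mw , mv , canon-≡⇒eq (_ , mw) (_ , mv) c

  classes-≡⇔eq : ∀ {χ θ l l′ v u} → ClassOf χ l → ClassOf θ l′ → lf v χ ∈ B → lf u θ ∈ B →
                 (l ≡ l′) ⇔ (eq v u ∈ B)
  classes-≡⇔eq cl cl′ mv mu = mk⇔
    (λ l≡l′ → canon-≡⇒eq (_ , mv) (_ , mu)
                (≡-trans (class-canon cl mv) (≡-trans l≡l′ (≡-sym (class-canon cl′ mu)))))
    (λ e → ≡-trans (≡-sym (class-canon cl mv))
             (≡-trans (canon-cong (_ , mv) e) (class-canon cl′ mu)))

  data Value : Set where
    class : Label → Value
    ¬ᶠ_ : Value → Value
    _⇒ᶠ_ _≡ᶠ_ : Value → Value → Value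

  NegationOf : Label → Label → Set
  NegationOf l u = ∃ λ χ → lf u (¬' χ) ∈ B × ClassOf χ l

  negationOf? : ∀ l → Dec (∃ (NegationOf l))
  negationOf? l = bounded-∃? (labs B)
    (λ u → bounded-∃? (formulas B) (λ χ → lf u (¬' χ) ∈? B ×-dec classOf? χ l)
      (λ (_ , _ , m , _) → lf∈⇒∈formulas m))
    (λ (_ , m , _) → lf∈⇒label∈labs m)

  CompoundOf : (Fm → Fm → Fm) → Label → Label → Label → Set
  CompoundOf op l l′ x = ∃₂ λ χ θ → lf x (op χ θ) ∈ B × ClassOf χ l × ClassOf θ l′

  compoundOf? : ∀ op l l′ → Dec (∃ (CompoundOf op l l′))
  compoundOf? op l l′ = bounded-∃? (labs B)
    (λ x → bounded-∃? (formulas B)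
      (λ χ → bounded-∃? (formulas B)
        (λ θ → lf x (op χ θ) ∈? B ×-dec classOf? χ l ×-dec classOf? θ l′)
        (λ (_ , _ , (_ , m , _)) → lf∈⇒∈formulas m))
      (λ (_ , _ , (_ , m , _) , _) → lf∈⇒∈formulas m))
    (λ (_ , _ , m , _) → lf∈⇒label∈labs m)

  negᵛ : Value → Value
  negᵛ (class l) with negationOf? l
  ... | yes (u , _) = class (canon u)
  ... | no _ = ¬ᶠ class l
  negᵛ a = ¬ᶠ a

  applyᵛ : (Fm → Fm → Fm) → (Value → Value → Value) → Value → Value → Value
  applyᵛ op free (class l) (class l′) with compoundOf? op l l′
  ... | yes (x , _) = class (canon x)
  ... | no _ = free (class l) (class l′)
  applyᵛ op free a b = free a b

  Designated : Value → Set
  Designated (class l) = Holds (sgn l)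
  Designated (¬ᶠ a) = ¬ Designated a
  Designated (a ⇒ᶠ b) = ¬ Designated a ⊎ Designated b
  Designated (a ≡ᶠ b) = a ≡ b

  negationOf-sgn : ∀ {l u} → NegationOf l u → sgn (canon u) ≡ negˢ (sgn l)
  negationOf-sgn (_ , mu , cl) with expanded mu
  ... | v , mv , s = ≡-trans (sgn-canon (_ , mu)) (≡-trans s (cong negˢ (class-sgn cl mv)))

  negᵛ-D : ∀ a → Designated (negᵛ a) ⇔ (¬ Designated a)
  negᵛ-D (class l) with negationOf? l
  ... | yes (_ , n) = subst (λ s → Holds s ⇔ _) (≡-sym (negationOf-sgn n)) (Holds-negˢ (sgn l))
  ... | no _ = ⇔-id _
  negᵛ-D (¬ᶠ a) = ⇔-id _
  negᵛ-D (a ⇒ᶠ b) = ⇔-id _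
  negᵛ-D (a ≡ᶠ b) = ⇔-id _

  applyᵛ-D : ∀ op free →
             (∀ {l l′ x} → CompoundOf op l l′ x →
                Designated (class (canon x)) ⇔ Designated (free (class l) (class l′))) →
             ∀ a b → Designated (applyᵛ op free a b) ⇔ Designated (free a b)
  applyᵛ-D op free compound-D (class l) (class l′) with compoundOf? op l l′
  ... | yes (_ , c) = compound-D c
  ... | no _ = ⇔-id _
  applyᵛ-D op free compound-D (class l) (¬ᶠ b) = ⇔-id _
  applyᵛ-D op free compound-D (class l) (b ⇒ᶠ b′) = ⇔-id _
  applyᵛ-D op free compound-D (class l) (b ≡ᶠ b′) = ⇔-id _
  applyᵛ-D op free compound-D (¬ᶠ a) b = ⇔-id _
  applyᵛ-D op free compound-D (a ⇒ᶠ a′) b = ⇔-id _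
  applyᵛ-D op free compound-D (a ≡ᶠ a′) b = ⇔-id _

  implication-D : ∀ {l l′ x} → CompoundOf _⇒_ l l′ x →
                  Designated (class (canon x)) ⇔ Designated (class l ⇒ᶠ class l′)
  implication-D {l} {l′} (_ , _ , mx , cl , cl′) with expanded mx
  ... | v , u , mv , mu , s = subst (λ s → Holds s ⇔ _) (≡-sym sgn-x) (Holds-⇒ˢ (sgn l) (sgn l′))
    where
    sgn-x = ≡-trans (sgn-canon (_ , mx))
                    (≡-trans s (cong₂ _⇒ˢ_ (class-sgn cl mv) (class-sgn cl′ mu)))

  equivalence-D : ∀ {l l′ x} → CompoundOf _≡'_ l l′ x →
                  Designated (class (canon x)) ⇔ Designated (class l ≡ᶠ class l′)
  equivalence-D {x = x} (_ , _ , mx , cl , cl′) with expanded mx | sgn-canon (_ , mx)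
  equivalence-D {x = pos , _} (_ , _ , mx , cl , cl′) | v , u , mv , mu , e | s rewrite s =
    mk⇔ (λ _ → cong class (Equivalence.from (classes-≡⇔eq cl cl′ mv mu) e)) (λ _ → tt)
  equivalence-D {x = neg , _} (_ , _ , mx , cl , cl′) | v , u , mv , mu , distinct | s rewrite s =
    mk⇔ ⊥-elim (λ { refl → refuted distinct (Equivalence.to (classes-≡⇔eq cl cl′ mv mu) refl) })
    where
    refuted : sgn v ≢ sgn u ⊎ neq v u ∈ B → eq v u ∈ B → ⊥
    refuted (inj₁ ≢sgn) e = ≢sgn (eq-sgn e)
    refuted (inj₂ m) e = not-closable (inj₁ (v , u , e , m))

  labelOf? : ∀ φ → Dec (∃ λ w → lf w φ ∈ B)
  labelOf? φ = bounded-∃? (labs B) (λ w → lf w φ ∈? B) lf∈⇒label∈labs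

  value : Fm → Value
  value (atom p) with labelOf? (atom p)
  ... | yes (w , _) = class (canon w)
  ... | no _ = class (pos , 0)
  value (¬' φ) = negᵛ (value φ)
  value (φ ⇒ ψ) = applyᵛ _⇒_ _⇒ᶠ_ (value φ) (value ψ)
  value (φ ≡' ψ) = applyᵛ _≡'_ _≡ᶠ_ (value φ) (value ψ)

  negᵛ-class : ∀ {w v φ} → lf w (¬' φ) ∈ B → lf v φ ∈ B → negᵛ (class (canon v)) ≡ class (canon w)
  negᵛ-class {w} {v} {φ} m mv with negationOf? (canon v)
  ... | yes (u , _ , mu , cl) =
    cong class (canon-cong (_ , mu) (eq-saturated (≡¬ (class-≈ cl mv) mu m)))
  ... | no none = ⊥-elim (none (w , φ , m , v , mv , refl))

  applyᵛ-class : ∀ op free →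
                 (∀ {φ ψ χ θ x z} → φ ≈[ B ] ψ → χ ≈[ B ] θ →
                    lf x (op φ χ) ∈ B → lf z (op ψ θ) ∈ B → EqInst B x z) →
                 ∀ {x v u φ ψ} → lf x (op φ ψ) ∈ B → lf v φ ∈ B → lf u ψ ∈ B →
                 applyᵛ op free (class (canon v)) (class (canon u)) ≡ class (canon x)
  applyᵛ-class op free congruence {x} {v} {u} {φ} {ψ} m mv mu
    with compoundOf? op (canon v) (canon u)
  ... | yes (y , _ , _ , my , cl , cl′) =
    cong class (canon-cong (_ , my)
      (eq-saturated (congruence (class-≈ cl mv) (class-≈ cl′ mu) my m)))
  ... | no none = ⊥-elim (none (x , φ , ψ , m , (v , mv , refl) , (u , mu , refl)))

  value-lf : ∀ φ {w} → lf w φ ∈ B → value φ ≡ class (canon w)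
  value-lf (atom p) m with labelOf? (atom p)
  ... | yes (w₀ , m₀) = cong class (canon-cong (_ , m₀) (eq-F m₀ m))
  ... | no none = ⊥-elim (none (_ , m))
  value-lf (¬' φ) m with expanded m
  ... | v , mv , _ rewrite value-lf φ mv = negᵛ-class m mv
  value-lf (φ ⇒ ψ) m with expanded m
  ... | v , u , mv , mu , _ rewrite value-lf φ mv | value-lf ψ mu =
    applyᵛ-class _⇒_ _⇒ᶠ_ ≡⇒ m mv mu
  value-lf (φ ≡' ψ) m with expanded m
  ... | v , u , mv , mu , _ rewrite value-lf φ mv | value-lf ψ mu =
    applyᵛ-class _≡'_ _≡ᶠ_ ≡≡ m mv mu

  model : Model
  model = record
    { U = Value
    ; inhab = class (pos , 0)
    ; D = Designated
    ; neg = negᵛ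
    ; imp = applyᵛ _⇒_ _⇒ᶠ_
    ; eqv = applyᵛ _≡'_ _≡ᶠ_
    ; neg-D = negᵛ-D
    ; imp-D = applyᵛ-D _⇒_ _⇒ᶠ_ implication-D
    ; eqv-D = applyᵛ-D _≡'_ _≡ᶠ_ equivalence-D
    }

  valuation : Valuation model
  valuation = record
    { V = value ; V-neg = λ _ → refl ; V-imp = λ _ _ → refl ; V-eqv = λ _ _ → refl }

  invalid : ∀ {k φ} → lf (neg , k) φ ∈ B → ¬ Valid φ
  invalid {φ = φ} m valid with value φ | value-lf φ m | valid model valuation
  ... | _ | refl | satisfied = subst Holds (sgn-canon (_ , m)) satisfied

saturate : ∀ n {φ k B used} Ls → Valid φ → lf (neg , k) φ ∈ B → FullyExpanded B → labs B ⊆ Ls →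
           missing B (cartesianProduct Ls Ls) < n → Closed B used
saturate (suc n) {B = B} Ls valid root full bound lt with closable? B
... | yes cl = close cl
... | no not-closable with newEquality? B
...   | no none = ⊥-elim (Countermodel.invalid B not-closable full (saturated B none) root valid)
...   | yes (w , v , ei , new) =
  eqr not-closable ei new (saturate n Ls valid (there root) full′ bound′ fewer)
  where
  w∈Ls = bound (proj₁ (eqInst-labels B ei))
  v∈Ls = bound (proj₂ (eqInst-labels B ei))
  full′ : FullyExpanded (eq w v ∷ B)
  full′ (there m) = Expanded-mono _ _ there (full m)
  bound′ : labs (eq w v ∷ B) ⊆ Ls
  bound′ (here refl) = w∈Ls
  bound′ (there (here refl)) = v∈Ls
  bound′ (there (there m)) = bound m
  fewer = <-≤-trans (missing-∷-< B _ (∈-cartesianProduct⁺ w∈Ls v∈Ls) new) (s≤s⁻¹ lt)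

theorem2 : (φ : Fm) → Valid φ → TableauProof φ
theorem2 φ valid = 0 , expand _ (n<1+n _) (Agenda-root (neg , 0) φ) close-expanded
  where
  close-expanded : ∀ {B} used → (lf (neg , 0) φ ∷ []) ⊆ B → FullyExpanded B → Closed B used
  close-expanded {B} used root full =
    saturate _ (labs B) valid (root (here refl)) full (λ m → m) (n<1+n _)
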